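{- Let $\Sigma_D$ be the $D$-basis of a reduced closure system $\langle S,\phi\rangle$. Let $<$ be any linear ordering on $\Sigma_D$ such that all implications of the form $y\rightarrow z$ (from the binary part) precede all implications of the form $X\rightarrow x$ where $X$ is a minimal cover of $x$. Then, with respect to this ordering, $\Sigma_D$ is an ordered direct basis, i.e. $\rho_{\Sigma_D}(X)=\phi(X)$ for all $X\subseteq S$.
   Context: A closure system is a pair $\langle S,\phi\rangle$ with $S$ a finite nonempty set and $\phi$ a closure operator on $2^S$; it is reduced if $\phi(\{i\})=\phi(\{j\})$ implies $i=j$. Write $\phi(y)$ for $\phi(\{y\})$. For $X,Y\subseteq S$, $X\ll Y$ means every $x\in X$ lies in $\phi(y)$ for some $y\in Y$. $X$ is a cover of $x$ if $x\in\phi(X)\setminus\bigcup_{x'\in X}\phi(x')$; a cover $Y$ of $x$ is minimal if for every cover $Z$ of $x$, $Z\ll Y$ implies $Y\subseteq Z$. The $D$-basis is $\Sigma_D=\{y\rightarrow x: y\in S,\ x\in\phi(y)\setminus\{y\}\}\cup\{X\rightarrow x: X\text{ a minimal cover of }x\}$; the first set is its binary part. For a linearly ordered set of implications $\Sigma=\{s_1,\dots,s_n\}$ with $s_k=A_k\rightarrow B_k$ ($B_k\subseteq S$; for a unit implication $A\rightarrow b$, $B=\{b\}$), the ordered iteration $\rho_\Sigma(X)$ is defined by $X_0=X$, $X_k=X_{k-1}\cup B_k$ if $A_k\subseteq X_{k-1}$ and $X_k=X_{k-1}$ otherwise, and $\rho_\Sigma(X)=X_n$. An ordered set of implications is an ordered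 direct basis if $\rho_\Sigma(X)$ equals the closure of $X$ for the closure system defined by $\Sigma$, for all $X\subseteq S$. -}

module Defs where

open import Data.Nat using (ℕ; suc)
open import Data.Fin using (Fin)
open import Data.Fin.Subset using (Subset; _∈_; _∉_; _⊆_; ⁅_⁆; _∪_)
open import Data.Fin.Subset.Properties using (_⊆?_)
open import Data.Product using (Σ; ∃; _×_; _,_)
open import Data.List using (List; foldl; _++_)
open import Data.List.Membership.Propositional as L using ()
open import Data.List.Relation.Unary.All using (All)
open import Data.List.Relation.Unary.Unique.Propositional using (Unique)
open import Relation.Nullary using (¬_; yes; no)
open import Relation.Binary.PropositionalEquality using (_≡_; _≢_)
open import Function.Bundles using (_⇔_)

record IsClosureOperator {n : ℕ} (φ : Subset n → Subset n) : Set where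
  field
    extensive  : ∀ X → X ⊆ φ X
    monotone   : ∀ {X Y} → X ⊆ Y → φ X ⊆ φ Y
    idempotent : ∀ X → φ (φ X) ≡ φ X

Reduced : {n : ℕ} → (Subset n → Subset n) → Set
Reduced φ = ∀ i j → φ ⁅ i ⁆ ≡ φ ⁅ j ⁆ → i ≡ j

Implication : ℕ → Set
Implication n = Subset n × Fin n

module _ {n : ℕ} (φ : Subset n → Subset n) where

  _≪_ : Subset n → Subset n → Set
  X ≪ Y = ∀ x → x ∈ X → ∃ λ y → y ∈ Y × x ∈ φ ⁅ y ⁆

  IsCover : Subset n → Fin n → Set
  IsCover X x = x ∈ φ X × (∀ x' → x' ∈ X → x ∉ φ ⁅ x' ⁆)

  IsMinimalCover : Subset n → Fin n → Set
  IsMinimalCover Y x = IsCover Y x × (∀ Z → IsCover Z x → Z ≪ Y → Y ⊆ Z)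

  IsBinaryPart : Implication n → Set
  IsBinaryPart (A , x) = ∃ λ y → A ≡ ⁅ y ⁆ × x ∈ φ ⁅ y ⁆ × x ≢ y

  IsCoverPart : Implication n → Set
  IsCoverPart (A , x) = IsMinimalCover A x

ρ-step : {n : ℕ} → Subset n → Implication n → Subset n
ρ-step X (A , b) with A ⊆? X
... | yes _ = X ∪ ⁅ b ⁆
... | no  _ = X

ρ : {n : ℕ} → List (Implication n) → Subset n → Subset n
ρ Σs X = foldl ρ-step X Σs

-- Every implication of the D-basis holds in ⟨S, φ⟩, so ρ(X) ⊆ φ(X). Conversely, once the binary
-- part has run, the current set contains the down-set ↓X = ⋃_{z ∈ X} φ(z). An element x of
-- φ(X) outside ↓X has ↓X as a cover, and below every cover lies a minimal cover Y ≪ ↓X; as ↓X is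
-- down-closed, Y ⊆ ↓X, so the implication Y → x of the cover part fires.
--
-- Minimal covers below a cover Z₀ are found in two steps: take a cover Y₁ ≪ Z₀ whose down-set is
-- as small as possible, then an antichain Y ⊆ Y₁ with the same down-set. If Z ≪ Y is another
-- cover, then ↓Z = ↓Y by the choice of Y₁, so each y ∈ Y lies in φ(z) for some z ∈ Z ⊆ ↓Y; the
-- antichain property gives φ(y) = φ(z), and reducedness y = z.
module Submission where

open import Defs
open import Data.Nat using (ℕ; suc)
open import Data.Fin.Subset using (Subset)
open import Data.Product using (_×_)
open import Data.Sum using (_⊎_)
open import Data.List using (List; _++_)
open import Data.List.Membership.Propositional using (_∈_)
open import Data.List.Relation.Unary.All using (All)
open import Data.List.Relation.Unary.Unique.Propositional using (Unique)
open import Relation.Binary.PropositionalEquality using (_≡_)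
open import Function.Bundles using (_⇔_)

open import Level using (Level)
open import Data.Nat using (_≤_; _<_; _<?_; s≤s)
open import Data.Nat.Properties using (≤-refl; ≤-trans; ≮⇒≥; <⇒≱)
open import Data.Fin using (Fin; _≟_)
open import Data.Fin.Subset
  using (_⊆_; ⁅_⁆; _-_; ∣_∣) renaming (_∈_ to _∈ₛ_; _∉_ to _∉ₛ_)
open import Data.Fin.Subset.Properties
  using ( _∈?_; _⊆?_; anySubset?; ⊆-refl; ⊆-trans; ⊆-antisym; x∈⁅x⁆; x∈⁅y⁆⇒x≡y
        ; p⊆p∪q; q⊆p∪q; x∈p∪q⁻; x∈p∧x≢y⇒x∈p-y; p─q⊆p; x∈p⇒∣p-x∣<∣p∣; p⊂q⇒∣p∣<∣q∣ )
open import Data.Fin.Properties using (any?; all?)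
open import Data.Product using (∃; _,_)
open import Data.Sum using (inj₁; inj₂; [_,_])
open import Data.Vec using (tabulate)
open import Data.Vec.Properties using (lookup∘tabulate; []=⇒lookup; lookup⇒[]=)
open import Data.List using (_∷_; [])
open import Data.List.Properties using (foldl-++)
open import Data.List.Relation.Unary.Any using (here; there)
open import Data.List.Membership.Propositional.Properties using (∈-++⁻)
import Data.List.Relation.Unary.All as All
open import Data.List.Relation.Unary.All.Properties using (++⁺)
open import Data.Empty using (⊥-elim)
open import Relation.Nullary using (yes; no; ¬_; does)
open import Relation.Nullary.Decidable using (_×-dec_; _→-dec_; ¬?; dec-true)
open import Relation.Unary using (Pred; Decidable)
open import Relation.Binary.PropositionalEquality using (_≢_; refl; sym; trans; subst)
open import Function.Bundles using (Equivalence)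

private
  variable
    n : ℕ
    ℓ : Level

module _ {P : Pred (Fin n) ℓ} (P? : Decidable P) where

  -- Abstract, so that down-sets ↓ Z below stay rigid for unification instead of unfolding
  -- into tabulated vectors.
  abstract
    fromDec : Subset n
    fromDec = tabulate (λ x → does (P? x))

    ∈fromDec⁺ : ∀ {x} → P x → x ∈ₛ fromDec
    ∈fromDec⁺ {x} px =
      lookup⇒[]= x fromDec (trans (lookup∘tabulate (λ y → does (P? y)) x) (dec-true (P? x) px))

    ∈fromDec⁻ : ∀ {x} → x ∈ₛ fromDec → P x
    ∈fromDec⁻ {x} x∈ with P? x | trans (sym (lookup∘tabulate (λ y → does (P? y)) x)) ([]=⇒lookup x∈)
    ... | yes px | _ = px
    ... | no _   | ()

module _ {P : Pred (Subset n) ℓ} (P? : Decidable P) (μ : Subset n → ℕ) where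

  ∃-minimal : ∀ {Y} → P Y → ∃ λ Z → P Z × (∀ {W} → P W → μ Z ≤ μ W)
  ∃-minimal = go _ ≤-refl
    where
    go : ∀ k {Y} → μ Y < k → P Y → ∃ λ Z → P Z × (∀ {W} → P W → μ Z ≤ μ W)
    go (suc k) {Y} (s≤s μY≤k) pY with anySubset? (λ W → P? W ×-dec (μ W <? μ Y))
    ... | yes (W , pW , μW<μY) = go k (≤-trans μW<μY μY≤k) pW
    ... | no ∄smaller          = Y , pY , λ {W} pW → ≮⇒≥ (λ μW<μY → ∄smaller (W , pW , μW<μY))

p⊆q∧∣q∣≤∣p∣⇒q⊆p : {p q : Subset n} → p ⊆ q → ∣ q ∣ ≤ ∣ p ∣ → q ⊆ p
p⊆q∧∣q∣≤∣p∣⇒q⊆p {p = p} p⊆q ∣q∣≤∣p∣ {x} x∈q with x ∈? p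
... | yes x∈p = x∈p
... | no  x∉p = ⊥-elim (<⇒≱ (p⊂q⇒∣p∣<∣q∣ (p⊆q , x , x∈q , x∉p)) ∣q∣≤∣p∣)


ρ-step-⊇ : ∀ (T : Subset n) s → T ⊆ ρ-step T s
ρ-step-⊇ T (A , b) with A ⊆? T
... | yes _ = p⊆p∪q ⁅ b ⁆
... | no  _ = λ x∈T → x∈T

ρ-⊇ : ∀ L (T : Subset n) → T ⊆ ρ L T
ρ-⊇ []      T x∈T = x∈T
ρ-⊇ (s ∷ L) T x∈T = ρ-⊇ L (ρ-step T s) (ρ-step-⊇ T s x∈T)

ρ-step-fires : ∀ (T : Subset n) A b → A ⊆ T → b ∈ₛ ρ-step T (A , b)
ρ-step-fires T A b A⊆T with A ⊆? T
... | yes _   = q⊆p∪q T ⁅ b ⁆ (x∈⁅x⁆ b)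
... | no  A⊈T = ⊥-elim (A⊈T A⊆T)

ρ-fires : ∀ L (T : Subset n) {A b} → (A , b) ∈ L → A ⊆ T → b ∈ₛ ρ L T
ρ-fires (s ∷ L) T (here refl) A⊆T = ρ-⊇ L _ (ρ-step-fires T _ _ A⊆T)
ρ-fires (s ∷ L) T (there i)   A⊆T = ρ-fires L (ρ-step T s) i (⊆-trans A⊆T (ρ-step-⊇ T s))

⁅⁆⊆ : ∀ {b : Fin n} {Z} → b ∈ₛ Z → ⁅ b ⁆ ⊆ Z
⁅⁆⊆ {b = b} b∈Z x∈⁅b⁆ = subst (_∈ₛ _) (sym (x∈⁅y⁆⇒x≡y b x∈⁅b⁆)) b∈Z

module ClosureSystem {φ : Subset n → Subset n} (cl : IsClosureOperator φ) where
  open IsClosureOperator cl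

  ⊆φ⇒φ⊆φ : ∀ {A B} → A ⊆ φ B → φ A ⊆ φ B
  ⊆φ⇒φ⊆φ {B = B} A⊆φB x∈ = subst (_ ∈ₛ_) (idempotent B) (monotone A⊆φB x∈)

  x∈φ⁅x⁆ : ∀ x → x ∈ₛ φ ⁅ x ⁆
  x∈φ⁅x⁆ x = extensive ⁅ x ⁆ (x∈⁅x⁆ x)

  ∈φ⁅⁆-trans : ∀ {a b c} → a ∈ₛ φ ⁅ b ⁆ → b ∈ₛ φ ⁅ c ⁆ → a ∈ₛ φ ⁅ c ⁆
  ∈φ⁅⁆-trans a∈ b∈ = ⊆φ⇒φ⊆φ (⁅⁆⊆ b∈) a∈

  Holds : Implication n → Set
  Holds (A , b) = b ∈ₛ φ A

  ρ-step-sound : ∀ {T X} s → Holds s → T ⊆ φ X → ρ-step T s ⊆ φ X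
  ρ-step-sound {T} {X} (A , b) b∈φA T⊆φX with A ⊆? T
  ... | no  _   = T⊆φX
  ... | yes A⊆T = λ x∈ → [ T⊆φX , b∈φX ] (x∈p∪q⁻ T ⁅ b ⁆ x∈)
    where
    b∈φX : ∀ {x} → x ∈ₛ ⁅ b ⁆ → x ∈ₛ φ X
    b∈φX x∈⁅b⁆ = ⁅⁆⊆ (⊆φ⇒φ⊆φ (⊆-trans A⊆T T⊆φX) b∈φA) x∈⁅b⁆

  ρ-sound : ∀ {L T X} → All Holds L → T ⊆ φ X → ρ L T ⊆ φ X
  ρ-sound All.[]         T⊆φX = T⊆φX
  ρ-sound (h All.∷ hs) T⊆φX = ρ-sound hs (ρ-step-sound _ h T⊆φX)

  binary-holds : ∀ {s} → IsBinaryPart φ s → Holds s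
  binary-holds (_ , refl , x∈φy , _) = x∈φy

  cover-holds : ∀ {s} → IsCoverPart φ s → Holds s
  cover-holds ((x∈φY , _) , _) = x∈φY

  binary-not-cover : ∀ {s} → IsBinaryPart φ s → ¬ IsCoverPart φ s
  binary-not-cover (y , refl , x∈φy , _) ((_ , uncovered) , _) = uncovered y (x∈⁅x⁆ y) x∈φy

  ↓_ : Subset n → Subset n
  ↓ Z = fromDec (λ w → any? (λ z → (z ∈? Z) ×-dec (w ∈? φ ⁅ z ⁆)))

  ∈↓⁺ : ∀ {Z w z} → z ∈ₛ Z → w ∈ₛ φ ⁅ z ⁆ → w ∈ₛ ↓ Z
  ∈↓⁺ z∈Z w∈φz = ∈fromDec⁺ _ (_ , z∈Z , w∈φz)

  ∈↓⁻ : ∀ {Z w} → w ∈ₛ ↓ Z → ∃ λ z → z ∈ₛ Z × w ∈ₛ φ ⁅ z ⁆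
  ∈↓⁻ = ∈fromDec⁻ _

  ⊆↓ : ∀ Z → Z ⊆ ↓ Z
  ⊆↓ Z z∈Z = ∈↓⁺ z∈Z (x∈φ⁅x⁆ _)

  ↓-downward : ∀ {Z v w} → w ∈ₛ ↓ Z → v ∈ₛ φ ⁅ w ⁆ → v ∈ₛ ↓ Z
  ↓-downward w∈↓Z v∈φw with ∈↓⁻ w∈↓Z
  ... | z , z∈Z , w∈φz = ∈↓⁺ z∈Z (∈φ⁅⁆-trans v∈φw w∈φz)

  ⊆↓⇒↓⊆↓ : ∀ {Z Y} → Z ⊆ ↓ Y → ↓ Z ⊆ ↓ Y
  ⊆↓⇒↓⊆↓ Z⊆↓Y w∈↓Z with ∈↓⁻ w∈↓Z
  ... | z , z∈Z , w∈φz = ↓-downward (Z⊆↓Y z∈Z) w∈φz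

  ↓⊆φ : ∀ Z → ↓ Z ⊆ φ Z
  ↓⊆φ Z w∈↓Z with ∈↓⁻ w∈↓Z
  ... | z , z∈Z , w∈φz = ⊆φ⇒φ⊆φ (⊆-trans (⁅⁆⊆ z∈Z) (extensive Z)) w∈φz

  ≪⇒⊆↓ : ∀ {Z Y} → _≪_ φ Z Y → Z ⊆ ↓ Y
  ≪⇒⊆↓ Z≪Y z∈Z with Z≪Y _ z∈Z
  ... | y , y∈Y , z∈φy = ∈↓⁺ y∈Y z∈φy

  cover? : ∀ x → Decidable (λ Z → IsCover φ Z x)
  cover? x Z = (x ∈? φ Z) ×-dec all? (λ z → (z ∈? Z) →-dec ¬? (x ∈? φ ⁅ z ⁆))

  cover-shrink : ∀ {Y Z x} → Z ⊆ Y → Y ⊆ ↓ Z → IsCover φ Y x → IsCover φ Z x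
  cover-shrink Z⊆Y Y⊆↓Z (x∈φY , uncovered) =
    ⊆φ⇒φ⊆φ (⊆-trans Y⊆↓Z (↓⊆φ _)) x∈φY , λ z z∈Z → uncovered z (Z⊆Y z∈Z)

  ↓-cover : ∀ {X x} → x ∈ₛ φ X → x ∉ₛ ↓ X → IsCover φ (↓ X) x
  ↓-cover {X} x∈φX x∉↓X = monotone (⊆↓ X) x∈φX , λ w w∈↓X x∈φw → x∉↓X (↓-downward w∈↓X x∈φw)

  Antichain : Subset n → Set
  Antichain Y = ∀ {y y'} → y ∈ₛ Y → y' ∈ₛ Y → y ∈ₛ φ ⁅ y' ⁆ → y ≡ y'

  ∃-antichain-⊆ : ∀ Y → ∃ λ Z → Z ⊆ Y × Y ⊆ ↓ Z × Antichain Z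
  ∃-antichain-⊆ Y with ∃-minimal (λ Z → (Z ⊆? Y) ×-dec (Y ⊆? ↓ Z)) ∣_∣ (⊆-refl , ⊆↓ Y)
  ... | Z , (Z⊆Y , Y⊆↓Z) , least = Z , Z⊆Y , Y⊆↓Z , antichain
    where
    antichain : Antichain Z
    antichain {y} {y'} y∈Z y'∈Z y∈φy' with y ≟ y'
    ... | yes y≡y' = y≡y'
    ... | no  y≢y' = ⊥-elim (<⇒≱ (x∈p⇒∣p-x∣<∣p∣ y∈Z) (least (⊆-trans (p─q⊆p Z ⁅ y ⁆) Z⊆Y , Y⊆↓Z-y)))
      where
      y'∈Z-y : y' ∈ₛ Z - y
      y'∈Z-y = x∈p∧x≢y⇒x∈p-y y'∈Z (λ y'≡y → y≢y' (sym y'≡y))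
      Z⊆↓Z-y : Z ⊆ ↓ (Z - y)
      Z⊆↓Z-y {w} w∈Z with w ≟ y
      ... | yes refl = ∈↓⁺ y'∈Z-y y∈φy'
      ... | no  w≢y  = ⊆↓ _ (x∈p∧x≢y⇒x∈p-y w∈Z w≢y)
      Y⊆↓Z-y : Y ⊆ ↓ (Z - y)
      Y⊆↓Z-y = ⊆-trans Y⊆↓Z (⊆↓⇒↓⊆↓ Z⊆↓Z-y)

  module _ (reduced : Reduced φ) where

    antichain⇒minimal : ∀ {Y x} → IsCover φ Y x → Antichain Y
                      → (∀ {Z} → IsCover φ Z x → Z ⊆ ↓ Y → ∣ ↓ Y ∣ ≤ ∣ ↓ Z ∣)
                      → IsMinimalCover φ Y x
    antichain⇒minimal {Y} covY antichain least = covY , minimal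
      where
      minimal : ∀ Z → IsCover φ Z _ → _≪_ φ Z Y → Y ⊆ Z
      minimal Z covZ Z≪Y {y} y∈Y
        with ∈↓⁻ (p⊆q∧∣q∣≤∣p∣⇒q⊆p (⊆↓⇒↓⊆↓ (≪⇒⊆↓ Z≪Y)) (least covZ (≪⇒⊆↓ Z≪Y)) (⊆↓ Y y∈Y))
      ... | z , z∈Z , y∈φz with Z≪Y z z∈Z
      ... | y' , y'∈Y , z∈φy' with antichain y∈Y y'∈Y (∈φ⁅⁆-trans y∈φz z∈φy')
      ... | refl = subst (_∈ₛ Z) (sym (reduced y z φy≡φz)) z∈Z
        where
        φy≡φz : φ ⁅ y ⁆ ≡ φ ⁅ z ⁆
        φy≡φz = ⊆-antisym (⊆φ⇒φ⊆φ (⁅⁆⊆ y∈φz)) (⊆φ⇒φ⊆φ (⁅⁆⊆ z∈φy'))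

    minimal-cover-below : ∀ {Z₀ x} → IsCover φ Z₀ x → ∃ λ Y → IsMinimalCover φ Y x × Y ⊆ ↓ Z₀
    minimal-cover-below {Z₀} {x} covZ₀
      with ∃-minimal {P = λ Z → IsCover φ Z x × Z ⊆ ↓ Z₀} (λ Z → cover? x Z ×-dec (Z ⊆? ↓ Z₀))
                     (λ Z → ∣ ↓ Z ∣) (covZ₀ , ⊆↓ Z₀)
    ... | Y₁ , (covY₁ , Y₁⊆↓Z₀) , least with ∃-antichain-⊆ Y₁
    ... | Y , Y⊆Y₁ , Y₁⊆↓Y , antichain =
      Y , antichain⇒minimal (cover-shrink Y⊆Y₁ Y₁⊆↓Y covY₁) antichain least-↓Y , ⊆-trans Y⊆Y₁ Y₁⊆↓Z₀
      where
      ↓Y≡↓Y₁ : ↓ Y ≡ ↓ Y₁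
      ↓Y≡↓Y₁ = ⊆-antisym (⊆↓⇒↓⊆↓ (⊆-trans Y⊆Y₁ (⊆↓ Y₁))) (⊆↓⇒↓⊆↓ Y₁⊆↓Y)
      least-↓Y : ∀ {Z} → IsCover φ Z x → Z ⊆ ↓ Y → ∣ ↓ Y ∣ ≤ ∣ ↓ Z ∣
      least-↓Y {Z} covZ Z⊆↓Y = subst (λ U → ∣ U ∣ ≤ ∣ ↓ Z ∣) (sym ↓Y≡↓Y₁)
        (least (covZ , ⊆-trans Z⊆↓Y (subst (_⊆ ↓ Z₀) (sym ↓Y≡↓Y₁) (⊆↓⇒↓⊆↓ Y₁⊆↓Z₀))))

    φ⊆ρ : ∀ {L T X} → (∀ {Y x} → IsMinimalCover φ Y x → (Y , x) ∈ L) → ↓ X ⊆ T → φ X ⊆ ρ L T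
    φ⊆ρ {L} {T} {X} covers ↓X⊆T {x} x∈φX with x ∈? ↓ X
    ... | yes x∈↓X = ρ-⊇ L T (↓X⊆T x∈↓X)
    ... | no  x∉↓X = fire (minimal-cover-below (↓-cover x∈φX x∉↓X))
      where
      fire : ∃ (λ Y → IsMinimalCover φ Y x × Y ⊆ ↓ ↓ X) → x ∈ₛ ρ L T
      fire (Y , minY , Y⊆↓↓X) = ρ-fires L T (covers minY) (⊆-trans Y⊆↓↓X (⊆-trans (⊆↓⇒↓⊆↓ ⊆-refl) ↓X⊆T))

  ↓⊆ρ : ∀ {L X} → (∀ {z w} → w ∈ₛ φ ⁅ z ⁆ → w ≢ z → (⁅ z ⁆ , w) ∈ L) → ↓ X ⊆ ρ L X
  ↓⊆ρ {L} {X} binaries {w} w∈↓X with ∈↓⁻ w∈↓X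
  ... | z , z∈X , w∈φz with w ≟ z
  ...   | yes refl = ρ-⊇ L X z∈X
  ...   | no  w≢z  = ρ-fires L X (binaries w∈φz w≢z) (⁅⁆⊆ z∈X)

theorem10 : (m : ℕ) (φ : Subset (suc m) → Subset (suc m))
    → IsClosureOperator φ → Reduced φ
    → (bin cov : List (Implication (suc m)))
    → All (IsBinaryPart φ) bin → All (IsCoverPart φ) cov
    → Unique (bin ++ cov)
    → (∀ s → (s ∈ bin ++ cov) ⇔ (IsBinaryPart φ s ⊎ IsCoverPart φ s))
    → ∀ X → ρ (bin ++ cov) X ≡ φ X
theorem10 m φ cl reduced bin cov binary cover _ basis X = ⊆-antisym sound complete
  where
  open ClosureSystem cl

  listed : ∀ {s} → IsBinaryPart φ s ⊎ IsCoverPart φ s → s ∈ bin ++ cov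
  listed {s} = Equivalence.from (basis s)

  sound : ρ (bin ++ cov) X ⊆ φ X
  sound = ρ-sound (++⁺ (All.map binary-holds binary) (All.map cover-holds cover))
                  (IsClosureOperator.extensive cl X)

  complete : φ X ⊆ ρ (bin ++ cov) X
  complete = subst (φ X ⊆_) (sym (foldl-++ ρ-step X bin cov)) (φ⊆ρ reduced in-cov (↓⊆ρ in-bin))
    where
    in-bin : ∀ {z w} → w ∈ₛ φ ⁅ z ⁆ → w ≢ z → (⁅ z ⁆ , w) ∈ bin
    in-bin w∈φz w≢z with ∈-++⁻ bin (listed (inj₁ (_ , refl , w∈φz , w≢z)))
    ... | inj₁ i = i
    ... | inj₂ i = ⊥-elim (binary-not-cover (_ , refl , w∈φz , w≢z) (All.lookup cover i))
    in-cov : ∀ {Y x} → IsMinimalCover φ Y x → (Y , x) ∈ cov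
    in-cov minY with ∈-++⁻ bin (listed (inj₂ minY))
    ... | inj₁ i = ⊥-elim (binary-not-cover (All.lookup binary i) minY)
    ... | inj₂ i = i
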